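{- For every $k\in\mathbb{N}$, $\mathrm{MTL}_{k+1}$ (MTL formulas of until rank at most $k+1$) and $\mathrm{TPTL}_k$ (TPTL formulas of until rank at most $k$) are incomparable in expressive power: each contains a formula not equivalent to any formula of the other.
   Context: Data words: infinite sequences $(P_0,d_0)(P_1,d_1)\dots$ with $P_i\subseteq\mathcal{P}$ (finite set of propositions) and $d_i\in\mathbb{N}$. Intervals are integer intervals with endpoints in $\mathbb{Z}\cup\{\pm\infty\}$. MTL: $\varphi::=p\mid\neg\varphi\mid\varphi_1\wedge\varphi_2\mid\varphi_1\mathsf{U}_I\varphi_2$; $(w,i)\models\varphi_1\mathsf{U}_I\varphi_2$ iff there is $j>i$ with $(w,j)\models\varphi_2$, $d_j-d_i\in I$, and $(w,k)\models\varphi_1$ for all $i<k<j$; $w\models\varphi$ iff $(w,0)\models\varphi$. TPTL: $\varphi::=p\mid x\in I\mid\neg\varphi\mid\varphi_1\wedge\varphi_2\mid\varphi_1\mathsf{U}\varphi_2\mid x.\varphi$; $(w,i,\nu)\models x\in I$ iff $d_i-\nu(x)\in I$; $(w,i,\nu)\models x.\varphi$ iff $(w,i,\nu[x\mapsto d_i])\models\varphi$; $(w,i,\nu)\models\varphi_1\mathsf{U}\varphi_2$ iff there is $j>i$ with $(w,j,\nu)\models\varphi_2$ and $(w,k,\nu)\models\varphi_1$ for all $i<k<j$; $w\models\varphi$ iff $(w,0,\nu_0)\models\varphi$ with $\nu_0$ mapping all registers to $d_0$. Until rank: $0$ for atoms ($p$, $x\in I$), unchanged by $\neg$ and $x.$,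 maximum for $\wedge$, and $\max+1$ for $\mathsf{U}_I$ / $\mathsf{U}$. Equivalence: same set of satisfying data words. -}

module Defs where

open import Data.Nat using (ℕ; zero; suc; _⊔_; _≤_; _<_; _≟_)
open import Data.Integer as ℤ using (ℤ; +_; _-_)
open import Data.Fin using (Fin)
open import Data.Bool using (Bool; true; false; T)
open import Data.Maybe using (Maybe; just; nothing)
open import Data.Product using (Σ; ∃; _×_; _,_)
open import Data.Unit using (⊤)
open import Relation.Nullary using (¬_; yes; no)

record Letter (n : ℕ) : Set where
  constructor ⟨_,_⟩
  field
    props : Fin n → Bool
    datum : ℕ
open Letter public

DataWord : ℕ → Set
DataWord n = ℕ → Letter n

-- Integer intervals with endpoints in ℤ ∪ {±∞}.
-- lower = nothing means -∞, upper = nothing means +∞; finite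
-- endpoints are inclusive (integer intervals).

record Interval : Set where
  constructor [_,_]
  field
    lower : Maybe ℤ
    upper : Maybe ℤ
open Interval public

LowerOK : Maybe ℤ → ℤ → Set
LowerOK nothing  z = ⊤
LowerOK (just a) z = a ℤ.≤ z

UpperOK : Maybe ℤ → ℤ → Set
UpperOK nothing  z = ⊤
UpperOK (just b) z = z ℤ.≤ b

_∈ᴵ_ : ℤ → Interval → Set
z ∈ᴵ I = LowerOK (lower I) z × UpperOK (upper I) z

diff : ℕ → ℕ → ℤ
diff d d' = (+ d) - (+ d')

data MTL (n : ℕ) : Set where
  prop : Fin n → MTL n
  ¬ₘ_  : MTL n → MTL n
  _∧ₘ_ : MTL n → MTL n → MTL n
  _U[_]_ : MTL n → Interval → MTL n → MTL n

Satₘ : ∀ {n} → DataWord n → ℕ → MTL n → Set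
Satₘ w i (prop p) = T (props (w i) p)
Satₘ w i (¬ₘ φ) = ¬ (Satₘ w i φ)
Satₘ w i (φ ∧ₘ ψ) = (Satₘ w i φ) × (Satₘ w i ψ)
Satₘ w i (φ U[ I ] ψ) =
  ∃ λ j → i < j × (Satₘ w j ψ) × (diff (datum (w j)) (datum (w i)) ∈ᴵ I)
        × (∀ k → i < k → k < j → Satₘ w k φ)

_⊨ₘ_ : ∀ {n} → DataWord n → MTL n → Set
w ⊨ₘ φ = Satₘ w 0 φ

rankₘ : ∀ {n} → MTL n → ℕ
rankₘ (prop p) = 0
rankₘ (¬ₘ φ) = rankₘ φ
rankₘ (φ ∧ₘ ψ) = rankₘ φ ⊔ rankₘ ψ
rankₘ (φ U[ I ] ψ) = suc (rankₘ φ ⊔ rankₘ ψ)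

Register : Set
Register = ℕ

Valuation : Set
Valuation = Register → ℕ

_[_↦_] : Valuation → Register → ℕ → Valuation
(ν [ x ↦ d ]) y with x ≟ y
... | yes _ = d
... | no  _ = ν y

data TPTL (n : ℕ) : Set where
  prop  : Fin n → TPTL n
  _∈ₜ_  : Register → Interval → TPTL n
  ¬ₜ_   : TPTL n → TPTL n
  _∧ₜ_  : TPTL n → TPTL n → TPTL n
  _Uₜ_  : TPTL n → TPTL n → TPTL n
  bind  : Register → TPTL n → TPTL n   -- x.φ

Satₜ : ∀ {n} → DataWord n → ℕ → Valuation → TPTL n → Set
Satₜ w i ν (prop p) = T (props (w i) p)
Satₜ w i ν (x ∈ₜ I) = diff (datum (w i)) (ν x) ∈ᴵ I
Satₜ w i ν (¬ₜ φ) = ¬ (Satₜ w i ν φ)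
Satₜ w i ν (φ ∧ₜ ψ) = (Satₜ w i ν φ) × (Satₜ w i ν ψ)
Satₜ w i ν (φ Uₜ ψ) =
  ∃ λ j → i < j × (Satₜ w j ν ψ) × (∀ k → i < k → k < j → Satₜ w k ν φ)
Satₜ w i ν (bind x φ) = Satₜ w i (ν [ x ↦ datum (w i) ]) φ

_⊨ₜ_ : ∀ {n} → DataWord n → TPTL n → Set
w ⊨ₜ φ = Satₜ w 0 (λ _ → datum (w 0)) φ

rankₜ : ∀ {n} → TPTL n → ℕ
rankₜ (prop p) = 0
rankₜ (x ∈ₜ I) = 0
rankₜ (¬ₜ φ) = rankₜ φ
rankₜ (φ ∧ₜ ψ) = rankₜ φ ⊔ rankₜ ψ
rankₜ (φ Uₜ ψ) = suc (rankₜ φ ⊔ rankₜ ψ)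
rankₜ (bind x φ) = rankₜ φ

_≡ₑ_ : ∀ {n} → MTL n → TPTL n → Set
φ ≡ₑ ψ = ∀ w → (w ⊨ₘ φ → w ⊨ₜ ψ) × (w ⊨ₜ ψ → w ⊨ₘ φ)

-- Both separations come from pairs of data words that the weaker logic cannot
-- tell apart.  In  marked m  the only p sits at position m and all data are 0, so
-- register constraints are constant and TPTL degenerates to LTL with strict until.
-- A formula of until rank r looks at most r steps towards the marker, hence it
-- cannot distinguish positions whose distances to the marker agree or both exceed
-- r (Indist).  So X^(k+1) p, of rank k+1, separates  marked (k+1)  from
-- marked (k+2), which no TPTL formula of rank k does.
-- Conversely, x.((x < 0) U (p ∧ x > 0)) has rank 1.  In  ladder B a  the
-- proposition holds at the odd positions, the data after position 0 are the
-- multiples of 2(B+1), and the initial datum lies halfway between the a-th and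
-- the (a+1)-th of them; the formula holds for a = 2 but not for a = 3.  An MTL
-- formula with constants at most B only sees on which side of the initial datum a
-- later datum lies, and the later suffixes of both ladders are translates of one
-- another, so it cannot separate the two ladders whatever its rank (the rank bound
-- on the MTL side is therefore unused).
module Submission where

open import Defs
open import Data.Nat using (ℕ; zero; suc; _+_; _*_; _≤_; _<_; _⊔_; _⊓_; _≡ᵇ_; _≟_; _≤?_; z≤n; s≤s; s≤s⁻¹)
open import Data.Nat.Properties
open import Data.Integer as ℤ using (ℤ; +_; -[1+_]; +≤+; -≤-; -≤+)
import Data.Integer.Properties as ℤP
open import Data.Bool using (Bool; false; true; T)
open import Data.Maybe using (Maybe; just; nothing)
open import Data.Fin using (zero)
open import Data.Product using (Σ; ∃; _×_; _,_; proj₁; proj₂)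
open import Data.Empty using (⊥-elim)
open import Relation.Nullary using (¬_; yes; no)
open import Relation.Binary.PropositionalEquality hiding ([_])
open import Algebra.Properties.CommutativeSemigroup +-commutativeSemigroup using (x∙yz≈yx∙z)

<⇒≡suc+ : ∀ {i j} → i < j → ∃ λ s → j ≡ suc s + i
<⇒≡suc+ {i} i<j with m≤n⇒∃[o]m+o≡n i<j
... | s , refl = s , cong suc (+-comm i s)

m+n≡o⇒m≤o : ∀ {m n o} → m + n ≡ o → m ≤ o
m+n≡o⇒m≤o {m} {n} refl = m≤m+n m n

+≡+⇒<ˡ : ∀ {a b x y} → a + x ≡ b + y → y < x → a < b
+≡+⇒<ˡ {a} {b} eq y<x with b ≤? a
... | yes b≤a = ⊥-elim (<-irrefl (sym eq) (+-mono-≤-< b≤a y<x))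
... | no b≰a  = ≰⇒> b≰a

+≡+⇒<ʳ : ∀ {a b x y} → a + x ≡ b + y → a < b → y < x
+≡+⇒<ʳ {x = x} {y} eq a<b with x ≤? y
... | yes x≤y = ⊥-elim (<-irrefl eq (+-mono-<-≤ a<b x≤y))
... | no x≰y  = ≰⇒> x≰y

diff-cancelˡ : ∀ a m n → diff (a + m) (a + n) ≡ diff m n
diff-cancelˡ a m n = begin
  diff (a + m) (a + n) ≡⟨ ℤP.m-n≡m⊖n (a + m) (a + n) ⟩
  (a + m) ℤ.⊖ (a + n)  ≡⟨ ℤP.+-cancelˡ-⊖ a m n ⟩
  m ℤ.⊖ n              ≡⟨ ℤP.m-n≡m⊖n m n ⟨
  diff m n             ∎
  where open ≡-Reasoning

diff-m+n-m : ∀ m n → diff (m + n) m ≡ + n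
diff-m+n-m m n = begin
  diff (m + n) m       ≡⟨ cong (diff (m + n)) (+-identityʳ m) ⟨
  diff (m + n) (m + 0) ≡⟨ diff-cancelˡ m n 0 ⟩
  diff n 0             ≡⟨ cong +_ (+-identityʳ n) ⟩
  + n                  ∎
  where open ≡-Reasoning

diff-m-m+1+n : ∀ m n → diff m (m + suc n) ≡ -[1+ n ]
diff-m-m+1+n m n =
  trans (cong (λ x → diff x (m + suc n)) (sym (+-identityʳ m))) (diff-cancelˡ m 0 (suc n))

diff-monoˡ-≤ : ∀ n {m o} → m ≤ o → diff m n ℤ.≤ diff o n
diff-monoˡ-≤ n m≤o = ℤP.+-monoˡ-≤ (ℤ.- + n) (+≤+ m≤o)

diff-monoʳ-≥ : ∀ m {n o} → n ≤ o → diff m o ℤ.≤ diff m n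
diff-monoʳ-≥ m n≤o = ℤP.+-monoʳ-≤ (+ m) (ℤP.neg-mono-≤ (+≤+ n≤o))

diff-above : ∀ {B m n} → n + suc B ≤ m → + suc B ℤ.≤ diff m n
diff-above {B} {m} {n} le = subst (ℤ._≤ diff m n) (diff-m+n-m n (suc B)) (diff-monoˡ-≤ n le)

diff-below : ∀ {B m n} → m + suc B ≤ n → diff m n ℤ.≤ -[1+ B ]
diff-below {B} {m} {n} le = subst (diff m n ℤ.≤_) (diff-m-m+1+n m B) (diff-monoʳ-≥ m le)

endpointBound : Maybe ℤ → ℕ
endpointBound nothing  = 0
endpointBound (just z) = ℤ.∣ z ∣

intervalBound : Interval → ℕ
intervalBound I = endpointBound (lower I) ⊔ endpointBound (upper I)

data SameSide (B : ℕ) (z z' : ℤ) : Set where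
  above : + suc B ℤ.≤ z → + suc B ℤ.≤ z' → SameSide B z z'
  below : z ℤ.≤ -[1+ B ] → z' ℤ.≤ -[1+ B ] → SameSide B z z'

LowerOK-sameSide : ∀ {B z z'} l → endpointBound l ≤ B → SameSide B z z' →
                   LowerOK l z → LowerOK l z'
LowerOK-sameSide nothing _ _ _ = _
LowerOK-sameSide (just (+ a)) a≤B (above _ B<z') _ = ℤP.≤-trans (+≤+ (m≤n⇒m≤1+n a≤B)) B<z'
LowerOK-sameSide (just (+ a)) _ (below z<-B _) a≤z with ℤP.≤-trans a≤z z<-B
... | ()
LowerOK-sameSide (just -[1+ a ]) _ (above _ B<z') _ = ℤP.≤-trans -≤+ B<z'
LowerOK-sameSide (just -[1+ a ]) a<B (below z<-B _) a≤z with ℤP.≤-trans a≤z z<-B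
... | -≤- B≤a = ⊥-elim (<⇒≱ a<B B≤a)

UpperOK-sameSide : ∀ {B z z'} u → endpointBound u ≤ B → SameSide B z z' →
                   UpperOK u z → UpperOK u z'
UpperOK-sameSide nothing _ _ _ = _
UpperOK-sameSide (just (+ a)) a≤B (above B<z _) z≤a with ℤP.≤-trans B<z z≤a
... | +≤+ B<a = ⊥-elim (<⇒≱ (s≤s a≤B) B<a)
UpperOK-sameSide (just (+ a)) _ (below _ z'<-B) _ = ℤP.≤-trans z'<-B -≤+
UpperOK-sameSide (just -[1+ a ]) _ (above B<z _) z≤a with ℤP.≤-trans B<z z≤a
... | ()
UpperOK-sameSide (just -[1+ a ]) a<B (below _ z'<-B) _ = ℤP.≤-trans z'<-B (-≤- (<⇒≤ a<B))

∈ᴵ-sameSide : ∀ {B z z'} I → intervalBound I ≤ B → SameSide B z z' → z ∈ᴵ I → z' ∈ᴵ I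
∈ᴵ-sameSide [ l , u ] bound side (l≤z , z≤u) =
  LowerOK-sameSide l (m⊔n≤o⇒m≤o _ _ bound) side l≤z ,
  UpperOK-sameSide u (m⊔n≤o⇒n≤o _ _ bound) side z≤u

record Matching (P : ℕ → ℕ → Set) (i i' j : ℕ) : Set where
  constructor matching
  field
    target  : ℕ
    after   : i' < target
    related : P j target
    between : ∀ k' → i' < k' → k' < target → ∃ λ k → i < k × k < j × P k k'

aligned-matching : ∀ {P i i' j} → (∀ s → P (s + i) (s + i')) → i < j → Matching P i i' j
aligned-matching {P} {i} {i'} shifted i<j with <⇒≡suc+ i<j
... | s , refl = matching (suc s + i') (s≤s (m≤n+m i' s)) (shifted (suc s)) between
  where
  between : ∀ k' → i' < k' → k' < suc s + i' → ∃ λ k → i < k × k < suc s + i × P k k'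
  between k' i'<k' k'<j' with <⇒≡suc+ i'<k'
  ... | u , refl = suc u + i , s≤s (m≤n+m i u) ,
                   +-monoˡ-< i (+-cancelʳ-< i' (suc u) (suc s) k'<j') , shifted (suc u)

elapsed : ∀ {n} → DataWord n → ℕ → ℕ → ℤ
elapsed w i j = diff (datum (w j)) (datum (w i))

record SuffixIso {n} (w : DataWord n) (i : ℕ) (w' : DataWord n) (i' : ℕ) : Set where
  constructor suffixIso
  field
    same-props   : ∀ t → props (w (t + i)) ≡ props (w' (t + i'))
    same-elapsed : ∀ s t → elapsed w (s + i) (t + i) ≡ elapsed w' (s + i') (t + i')

SuffixIso-translate : ∀ {n} {w w' : DataWord n} {i i'} c →
  (∀ t → w' (t + i') ≡ ⟨ props (w (t + i)) , c + datum (w (t + i)) ⟩) → SuffixIso w i w' i'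
SuffixIso-translate c translated =
  suffixIso (λ t → cong props (sym (translated t)))
  (λ s t → sym (trans (cong₂ diff (cong datum (translated t)) (cong datum (translated s)))
                      (diff-cancelˡ c _ _)))

SuffixIso-sym : ∀ {n} {w w' : DataWord n} {i i'} → SuffixIso w i w' i' → SuffixIso w' i' w i
SuffixIso-sym (suffixIso same-props same-elapsed) =
  suffixIso (λ t → sym (same-props t)) (λ s t → sym (same-elapsed s t))

SuffixIso-shift : ∀ {n} {w w' : DataWord n} {i i'} → SuffixIso w i w' i' →
                  ∀ u → SuffixIso w (u + i) w' (u + i')
SuffixIso-shift {w = w} {w'} {i} {i'} (suffixIso same-props same-elapsed) u = suffixIso
  (λ t → trans (cong (λ x → props (w x)) (sym (+-assoc t u i)))
         (trans (same-props (t + u)) (cong (λ x → props (w' x)) (+-assoc t u i'))))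
  (λ s t → trans (cong₂ (elapsed w) (sym (+-assoc s u i)) (sym (+-assoc t u i)))
           (trans (same-elapsed (s + u) (t + u))
                  (cong₂ (elapsed w') (+-assoc s u i') (+-assoc t u i'))))

Satₘ-SuffixIso : ∀ {n} (φ : MTL n) {w w' i i'} → SuffixIso w i w' i' → Satₘ w i φ → Satₘ w' i' φ
Satₘ-SuffixIso (prop p) iso sat = subst (λ P → T (P p)) (SuffixIso.same-props iso 0) sat
Satₘ-SuffixIso (¬ₘ φ) iso ¬sat sat = ¬sat (Satₘ-SuffixIso φ (SuffixIso-sym iso) sat)
Satₘ-SuffixIso (φ ∧ₘ ψ) iso (sφ , sψ) = Satₘ-SuffixIso φ iso sφ , Satₘ-SuffixIso ψ iso sψ
Satₘ-SuffixIso (φ U[ I ] ψ) {w} {w'} {i} {i'} iso (j , i<j , sψ , j∈I , sφ)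
  with aligned-matching {P = λ k k' → SuffixIso w k w' k' × elapsed w i k ≡ elapsed w' i' k'}
                        (λ u → SuffixIso-shift iso u , SuffixIso.same-elapsed iso 0 u) i<j
... | matching j' i'<j' (isoⱼ , elapsedⱼ) between =
  j' , i'<j' , Satₘ-SuffixIso ψ isoⱼ sψ , subst (_∈ᴵ I) elapsedⱼ j∈I ,
  λ k' i'<k' k'<j' → let k , i<k , k<j , isoₖ , _ = between k' i'<k' k'<j'
                     in Satₘ-SuffixIso φ isoₖ (sφ k i<k k<j)

boundₘ : ∀ {n} → MTL n → ℕ
boundₘ (prop p)     = 0
boundₘ (¬ₘ φ)       = boundₘ φ
boundₘ (φ ∧ₘ ψ)     = boundₘ φ ⊔ boundₘ ψ
boundₘ (φ U[ I ] ψ) = intervalBound I ⊔ (boundₘ φ ⊔ boundₘ ψ)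

Simulates : ∀ {n} → ℕ → DataWord n → DataWord n → Set
Simulates B w w' = ∀ j → 0 < j →
  Σ (Matching (λ k k' → SuffixIso w k w' k') 0 0 j) λ μ →
    SameSide B (elapsed w 0 j) (elapsed w' 0 (Matching.target μ))

-- An until at position 0 compares its witness with the initial datum only, so it
-- suffices that the witnesses lie on the same side of it; everything later is
-- carried by suffix isomorphisms.
Satₘ-initial : ∀ {n B} {w w' : DataWord n} → props (w 0) ≡ props (w' 0) →
  Simulates B w w' → Simulates B w' w → ∀ φ → boundₘ φ ≤ B → Satₘ w 0 φ → Satₘ w' 0 φ
Satₘ-initial same sim sim' (prop p) _ sat = subst (λ P → T (P p)) same sat
Satₘ-initial same sim sim' (¬ₘ φ) b ¬sat sat = ¬sat (Satₘ-initial (sym same) sim' sim φ b sat)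
Satₘ-initial same sim sim' (φ ∧ₘ ψ) b (sφ , sψ) =
  Satₘ-initial same sim sim' φ (m⊔n≤o⇒m≤o _ _ b) sφ ,
  Satₘ-initial same sim sim' ψ (m⊔n≤o⇒n≤o _ _ b) sψ
Satₘ-initial same sim sim' (φ U[ I ] ψ) b (j , 0<j , sψ , j∈I , sφ)
  with sim j 0<j
... | matching j' 0<j' isoⱼ between , side =
  j' , 0<j' , Satₘ-SuffixIso ψ isoⱼ sψ , ∈ᴵ-sameSide I (m⊔n≤o⇒m≤o _ _ b) side j∈I ,
  λ k' 0<k' k'<j' → let k , 0<k , k<j , isoₖ = between k' 0<k' k'<j'
                    in Satₘ-SuffixIso φ isoₖ (sφ k 0<k k<j)

odd : ℕ → Bool
odd zero          = false
odd (suc zero)    = true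
odd (suc (suc i)) = odd i

rung : ℕ → ℕ
rung B = suc B + suc B

height : ℕ → ℕ → ℕ → ℕ
height B a zero    = a * rung B + suc B
height B a (suc i) = suc i * rung B

height-below : ∀ B a x → suc x ≤ a → diff (height B a (suc x)) (height B a 0) ℤ.≤ -[1+ B ]
height-below B a x le = diff-below (+-monoˡ-≤ (suc B) (*-monoˡ-≤ (rung B) le))

height-above : ∀ B a x → a < suc x → + suc B ℤ.≤ diff (height B a (suc x)) (height B a 0)
height-above B a x lt = diff-above (begin
  a * rung B + suc B + suc B ≡⟨ +-assoc (a * rung B) (suc B) (suc B) ⟩
  a * rung B + rung B        ≡⟨ +-comm (a * rung B) (rung B) ⟩
  suc a * rung B             ≤⟨ *-monoˡ-≤ (rung B) lt ⟩
  suc x * rung B             ∎)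
  where open ≤-Reasoning

heights-below : ∀ B a a' x x' → suc x ≤ a → suc x' ≤ a' →
  SameSide B (diff (height B a (suc x)) (height B a 0)) (diff (height B a' (suc x')) (height B a' 0))
heights-below B a a' x x' le le' = below (height-below B a x le) (height-below B a' x' le')

heights-above : ∀ B a a' x x' → a < suc x → a' < suc x' →
  SameSide B (diff (height B a (suc x)) (height B a 0)) (diff (height B a' (suc x')) (height B a' 0))
heights-above B a a' x x' lt lt' = above (height-above B a x lt) (height-above B a' x' lt')

module _ {n : ℕ} where

  ladder : ℕ → ℕ → DataWord n
  ladder B a i = ⟨ (λ _ → odd i) , height B a i ⟩

  ladder-suffix : ∀ B a a' i → SuffixIso (ladder B a) (suc i) (ladder B a') (suc i)
  ladder-suffix B a a' i = SuffixIso-translate 0 same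
    where
    same : ∀ t → ladder B a' (t + suc i) ≡ ⟨ props (ladder B a (t + suc i)) , datum (ladder B a (t + suc i)) ⟩
    same t rewrite +-suc t i = refl

  ladder-period : ∀ B a a' i → SuffixIso (ladder B a) (suc i) (ladder B a') (3 + i)
  ladder-period B a a' i = SuffixIso-translate (rung B + rung B) two-rungs-up
    where
    two-rungs-up : ∀ t → ladder B a' (t + (3 + i))
                       ≡ ⟨ props (ladder B a (t + suc i)) , rung B + rung B + datum (ladder B a (t + suc i)) ⟩
    two-rungs-up t rewrite +-suc t (2 + i) | +-suc t (1 + i) | +-suc t i =
      cong (λ d → ⟨ (λ _ → odd (suc (t + i))) , d ⟩) (sym (+-assoc (rung B) (rung B) _))

  ladder-between-same : ∀ B a a' j k' → 0 < k' → k' < j →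
    ∃ λ k → 0 < k × k < j × SuffixIso (ladder B a) k (ladder B a') k'
  ladder-between-same B a a' j (suc y) 0<k' k'<j = suc y , 0<k' , k'<j , ladder-suffix B a a' y

  ladder₂-simulates-ladder₃ : ∀ B → Simulates B (ladder B 2) (ladder B 3)
  ladder₂-simulates-ladder₃ B (suc zero) _ =
    matching 1 (s≤s z≤n) (ladder-suffix B 2 3 0) (λ { (suc _) _ (s≤s ()) }) ,
    heights-below B 2 3 0 0 (s≤s z≤n) (s≤s z≤n)
  ladder₂-simulates-ladder₃ B (suc (suc zero)) _ =
    matching 2 (s≤s z≤n) (ladder-suffix B 2 3 1) (ladder-between-same B 2 3 2) ,
    heights-below B 2 3 1 1 (s≤s (s≤s z≤n)) (s≤s (s≤s z≤n))
  ladder₂-simulates-ladder₃ B (suc (suc (suc x))) _ =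
    matching (5 + x) (s≤s z≤n) (ladder-period B 2 3 (2 + x)) between ,
    heights-above B 2 3 (2 + x) (4 + x) (s≤s (s≤s (s≤s z≤n))) (s≤s (s≤s (s≤s (s≤s z≤n))))
    where
    between : ∀ k' → 0 < k' → k' < 5 + x →
              ∃ λ k → 0 < k × k < 3 + x × SuffixIso (ladder B 2) k (ladder B 3) k'
    between (suc zero)          _ _  = 1 , s≤s z≤n , s≤s (s≤s z≤n) , ladder-suffix B 2 3 0
    between (suc (suc zero))    _ _  = 2 , s≤s z≤n , s≤s (s≤s (s≤s z≤n)) , ladder-suffix B 2 3 1
    between (suc (suc (suc y))) _ lt = suc y , s≤s z≤n , s≤s⁻¹ (s≤s⁻¹ lt) , ladder-period B 2 3 y

  ladder₃-simulates-ladder₂ : ∀ B → Simulates B (ladder B 3) (ladder B 2)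
  ladder₃-simulates-ladder₂ B (suc zero) _ =
    matching 1 (s≤s z≤n) (ladder-suffix B 3 2 0) (λ { (suc _) _ (s≤s ()) }) ,
    heights-below B 3 2 0 0 (s≤s z≤n) (s≤s z≤n)
  ladder₃-simulates-ladder₂ B (suc (suc zero)) _ =
    matching 2 (s≤s z≤n) (ladder-suffix B 3 2 1) (ladder-between-same B 3 2 2) ,
    heights-below B 3 2 1 1 (s≤s (s≤s z≤n)) (s≤s (s≤s z≤n))
  ladder₃-simulates-ladder₂ B (suc (suc (suc zero))) _ =
    matching 1 (s≤s z≤n) (SuffixIso-sym (ladder-period B 2 3 0)) (λ { (suc _) _ (s≤s ()) }) ,
    heights-below B 3 2 2 0 (s≤s (s≤s (s≤s z≤n))) (s≤s z≤n)
  ladder₃-simulates-ladder₂ B (suc (suc (suc (suc x)))) _ =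
    matching (4 + x) (s≤s z≤n) (ladder-suffix B 3 2 (3 + x)) (ladder-between-same B 3 2 (4 + x)) ,
    heights-above B 3 2 (3 + x) (3 + x) (s≤s (s≤s (s≤s (s≤s z≤n)))) (s≤s (s≤s (s≤s z≤n)))

ladder₂⊨⇒ladder₃⊨ : ∀ {n B} (φ : MTL n) → boundₘ φ ≤ B → ladder B 2 ⊨ₘ φ → ladder B 3 ⊨ₘ φ
ladder₂⊨⇒ladder₃⊨ {B = B} =
  Satₘ-initial refl (ladder₂-simulates-ladder₃ B) (ladder₃-simulates-ladder₂ B)

negative positive : Interval
negative = [ nothing , just -[1+ 0 ] ]
positive = [ just (+ 1) , nothing ]

belowUntilMarkedAbove : ∀ {n} → TPTL (suc n)
belowUntilMarkedAbove = (0 ∈ₜ negative) Uₜ (prop zero ∧ₜ (0 ∈ₜ positive))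

above⇒∈positive : ∀ {B z} → + suc B ℤ.≤ z → z ∈ᴵ positive
above⇒∈positive B<z = ℤP.≤-trans (+≤+ (s≤s z≤n)) B<z , _

below⇒∈negative : ∀ {B z} → z ℤ.≤ -[1+ B ] → z ∈ᴵ negative
below⇒∈negative z<-B = _ , ℤP.≤-trans z<-B (-≤- z≤n)

below⇒∉positive : ∀ {B z} → z ℤ.≤ -[1+ B ] → ¬ (z ∈ᴵ positive)
below⇒∉positive z<-B (1≤z , _) with ℤP.≤-trans 1≤z z<-B
... | ()

above⇒∉negative : ∀ {B z} → + suc B ℤ.≤ z → ¬ (z ∈ᴵ negative)
above⇒∉negative B<z (_ , z≤-1) with ℤP.≤-trans B<z z≤-1
... | ()

ladder₂⊨belowUntilMarkedAbove : ∀ {n} B → ladder {suc n} B 2 ⊨ₜ belowUntilMarkedAbove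
ladder₂⊨belowUntilMarkedAbove B =
  3 , s≤s z≤n , (_ , above⇒∈positive (height-above B 2 2 (s≤s (s≤s (s≤s z≤n))))) , between
  where
  between : ∀ k → 0 < k → k < 3 → diff (height B 2 k) (height B 2 0) ∈ᴵ negative
  between (suc zero)       _ _ = below⇒∈negative (height-below B 2 0 (s≤s z≤n))
  between (suc (suc zero)) _ _ = below⇒∈negative (height-below B 2 1 (s≤s (s≤s z≤n)))
  between (suc (suc (suc _))) _ (s≤s (s≤s (s≤s ())))

ladder₃⊭belowUntilMarkedAbove : ∀ {n} B → ¬ (ladder {suc n} B 3 ⊨ₜ belowUntilMarkedAbove)
ladder₃⊭belowUntilMarkedAbove B (1 , _ , (_ , 1∈) , _) =
  below⇒∉positive (height-below B 3 0 (s≤s z≤n)) 1∈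
ladder₃⊭belowUntilMarkedAbove B (2 , _ , (() , _) , _)
ladder₃⊭belowUntilMarkedAbove B (3 , _ , (_ , 3∈) , _) =
  below⇒∉positive (height-below B 3 2 (s≤s (s≤s (s≤s z≤n)))) 3∈
ladder₃⊭belowUntilMarkedAbove B (4 , _ , (() , _) , _)
ladder₃⊭belowUntilMarkedAbove B (suc (suc (suc (suc (suc _)))) , _ , _ , between) =
  above⇒∉negative (height-above B 3 3 (s≤s (s≤s (s≤s (s≤s z≤n)))))
                  (between 4 (s≤s z≤n) (s≤s (s≤s (s≤s (s≤s (s≤s z≤n))))))

marked : ∀ {n} → ℕ → DataWord n
marked m i = ⟨ (λ _ → i ≡ᵇ m) , 0 ⟩

data Indist (r m i m' i' : ℕ) : Set where
  bothPast     : m < i → m' < i' → Indist r m i m' i'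
  sameDistance : ∀ t → i + t ≡ m → i' + t ≡ m' → Indist r m i m' i'
  bothFar      : ∀ t t' → i + t ≡ m → i' + t' ≡ m' → r < t → r < t' → Indist r m i m' i'

Indist-sym : ∀ {r m i m' i'} → Indist r m i m' i' → Indist r m' i' m i
Indist-sym (bothPast p p')             = bothPast p' p
Indist-sym (sameDistance t h h')       = sameDistance t h' h
Indist-sym (bothFar t t' h h' far far') = bothFar t' t h' h far' far

Indist-marker : ∀ {r m i m' i'} → Indist r m i m' i' → i ≡ m → i' ≡ m'
Indist-marker (bothPast m<i _) refl = ⊥-elim (<-irrefl refl m<i)
Indist-marker {i' = i'} (sameDistance zero _ h') refl = trans (sym (+-identityʳ i')) h'
Indist-marker {i = i} (sameDistance (suc t) h _) refl = ⊥-elim (m+1+n≢m i h)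
Indist-marker {i = i} (bothFar (suc t) _ h _ _ _) refl = ⊥-elim (m+1+n≢m i h)

past-shift : ∀ {r m i m' i'} → m < i → m' < i' → ∀ s → Indist r m (s + i) m' (s + i')
past-shift {i = i} {i' = i'} m<i m'<i' s =
  bothPast (<-≤-trans m<i (m≤n+m i s)) (<-≤-trans m'<i' (m≤n+m i' s))

distance-shift : ∀ {r m i m' i' t} → i + t ≡ m → i' + t ≡ m' → ∀ s → Indist r m (s + i) m' (s + i')
distance-shift {t = t} h h' s with s ≤? t
... | yes s≤t with m≤n⇒∃[o]m+o≡n s≤t
...   | d , refl = sameDistance d (moved h) (moved h')
  where
  moved : ∀ {j n} → j + (s + d) ≡ n → s + j + d ≡ n
  moved {j} = trans (sym (x∙yz≈yx∙z j s d))
distance-shift {t = t} h h' s | no s≰t = bothPast (reach h) (reach h')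
  where
  reach : ∀ {j n} → j + t ≡ n → n < s + j
  reach {j} refl = subst (j + t <_) (+-comm j s) (+-monoʳ-< j (≰⇒> s≰t))

Reply : ℕ → ℕ → ℕ → ℕ → ℕ → ℕ → Set
Reply r m i m' i' j = Matching (λ k k' → Indist r m k m' k') i i' j

position-at-distance : ∀ {i t m d} → i + t ≡ m → d < t → ∃ λ k → i < k × k + d ≡ m
position-at-distance {i} h d<t with <⇒≡suc+ d<t
... | e , refl = i + suc e , m<m+n i (s≤s z≤n) , trans (+-assoc i (suc e) _) h

realise : ∀ {r m i t m' k' u'} → i + t ≡ m → suc r < t → k' + u' ≡ m' →
  ∃ λ k → i < k × k + (u' ⊓ suc r) ≡ m × Indist r m k m' k'
realise {r} {u' = u'} h far h' with u' ≤? r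
... | yes u'≤r with position-at-distance h (<-trans (s≤s u'≤r) far)
...   | k , i<k , hk =
  k , i<k , trans (cong (λ d → k + d) (m≤n⇒m⊓n≡m (m≤n⇒m≤1+n u'≤r))) hk , sameDistance u' hk h'
realise {r} {u' = u'} h far h' | no u'≰r with position-at-distance h far
...   | k , i<k , hk =
  k , i<k , trans (cong (λ d → k + d) (m≥n⇒m⊓n≡n (≰⇒> u'≰r))) hk ,
  bothFar (suc r) u' hk h' (n<1+n r) (≰⇒> u'≰r)

far-past : ∀ {r m i m' i' j t t'} → i + t ≡ m → i' + t' ≡ m' → suc r < t → m < j →
           Reply r m i m' i' j
far-past {r} {m} {i} {m'} {i'} {j} h h' far m<j =
  matching (suc m') (s≤s (m+n≡o⇒m≤o h')) (bothPast m<j (n<1+n m')) between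
  where
  between : ∀ k' → i' < k' → k' < suc m' → ∃ λ k → i < k × k < j × Indist r m k m' k'
  between k' _ k'<1+m' with m≤n⇒∃[o]m+o≡n (s≤s⁻¹ k'<1+m')
  ... | u' , hk' with realise h far hk'
  ...   | k , i<k , hk , indist = k , i<k , ≤-<-trans (m+n≡o⇒m≤o hk) m<j , indist

far-near : ∀ {r m i m' i' j t t' s} → i + t ≡ m → i' + t' ≡ m' → suc r < t → suc r < t' →
           j + s ≡ m → s ≤ r → Reply r m i m' i' j
far-near {r} {m} {i} {m'} {i'} {j} {s = s} h h' far far' js s≤r
  with position-at-distance h' (<-trans (s≤s s≤r) far')
... | j' , i'<j' , js' = matching j' i'<j' (sameDistance s js js') between
  where
  between : ∀ k' → i' < k' → k' < j' → ∃ λ k → i < k × k < j × Indist r m k m' k'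
  between k' _ k'<j' with m≤n⇒∃[o]m+o≡n (<⇒≤ k'<j')
  ... | a , ka with trans (sym (+-assoc k' a s)) (cong (_+ s) ka)
  ...   | k'+a+s≡j'+s with realise h far (trans k'+a+s≡j'+s js')
  ...     | k , i<k , hk , indist =
    k , i<k , +≡+⇒<ˡ (trans hk (sym js)) (⊓-glb (+≡+⇒<ʳ k'+a+s≡j'+s k'<j') (s≤s s≤r)) , indist

far-far : ∀ {r m i m' i' j t' s} → i' + t' ≡ m' → suc r < t' → j + s ≡ m → r < s →
          Reply r m i m' i' j
far-far {i' = i'} {t' = suc e} h' (s≤s far') js r<s =
  matching (suc i') (n<1+n i') (bothFar _ e js (trans (sym (+-suc i' e)) h') r<s far')
           (λ k' i'<k' k'<1+i' → ⊥-elim (<⇒≱ i'<k' (s≤s⁻¹ k'<1+i')))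

far-reply : ∀ {r m i m' i' j t t'} → i + t ≡ m → i' + t' ≡ m' → suc r < t → suc r < t' →
            Reply r m i m' i' j
far-reply {r} {m} {j = j} h h' far far' with j ≤? m
... | no j≰m = far-past h h' far (≰⇒> j≰m)
... | yes j≤m with m≤n⇒∃[o]m+o≡n j≤m
...   | s , js with s ≤? r
...     | yes s≤r = far-near h h' far far' js s≤r
...     | no s≰r  = far-far h' far' js (≰⇒> s≰r)

Indist-step : ∀ {r m i m' i' j} → Indist (suc r) m i m' i' → i < j → Reply r m i m' i' j
Indist-step (bothPast p p')              i<j = aligned-matching (past-shift p p') i<j
Indist-step (sameDistance t h h')        i<j = aligned-matching (distance-shift h h') i<j
Indist-step (bothFar _ _ h h' far far') _    = far-reply h h' far far'

-- All data of marked words are 0, so both sides can share one valuation.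
Satₜ-Indist : ∀ {n r m i m' i' ν} (ψ : TPTL n) → rankₜ ψ ≤ r → Indist r m i m' i' →
              Satₜ (marked m) i ν ψ → Satₜ (marked m') i' ν ψ
Satₜ-Indist (prop p) _ indist sat = ≡⇒≡ᵇ _ _ (Indist-marker indist (≡ᵇ⇒≡ _ _ sat))
Satₜ-Indist (x ∈ₜ I) _ _ sat = sat
Satₜ-Indist (¬ₜ ψ) rk indist ¬sat sat = ¬sat (Satₜ-Indist ψ rk (Indist-sym indist) sat)
Satₜ-Indist (ψ ∧ₜ χ) rk indist (sψ , sχ) =
  Satₜ-Indist ψ (m⊔n≤o⇒m≤o _ _ rk) indist sψ , Satₜ-Indist χ (m⊔n≤o⇒n≤o _ _ rk) indist sχ
Satₜ-Indist (ψ Uₜ χ) (s≤s rk) indist (j , i<j , sχ , sψ) with Indist-step indist i<j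
... | matching j' i'<j' indistⱼ between =
  j' , i'<j' , Satₜ-Indist χ (m⊔n≤o⇒n≤o _ _ rk) indistⱼ sχ ,
  λ k' i'<k' k'<j' → let k , i<k , k<j , indistₖ = between k' i'<k' k'<j'
                     in Satₜ-Indist ψ (m⊔n≤o⇒m≤o _ _ rk) indistₖ (sψ k i<k k<j)
Satₜ-Indist (bind x ψ) rk indist sat = Satₜ-Indist ψ rk indist sat

⊥ₘ : ∀ {n} → MTL (suc n)
⊥ₘ = prop zero ∧ₘ (¬ₘ prop zero)

Xₘ : ∀ {n} → MTL (suc n) → MTL (suc n)
Xₘ φ = ⊥ₘ U[ [ nothing , nothing ] ] φ

Satₘ-Xₘ⁺ : ∀ {n} {w : DataWord (suc n)} {i} φ → Satₘ w (suc i) φ → Satₘ w i (Xₘ φ)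
Satₘ-Xₘ⁺ {i = i} φ sat =
  suc i , n<1+n i , sat , (_ , _) , λ k i<k k<1+i → ⊥-elim (<⇒≱ i<k (s≤s⁻¹ k<1+i))

Satₘ-Xₘ⁻ : ∀ {n} {w : DataWord (suc n)} {i} φ → Satₘ w i (Xₘ φ) → Satₘ w (suc i) φ
Satₘ-Xₘ⁻ {i = i} φ (l , i<l , sat , _ , between) with l ≟ suc i
... | yes refl = sat
... | no l≢1+i with between (suc i) (n<1+n i) (≤∧≢⇒< i<l (λ eq → l≢1+i (sym eq)))
...   | p , ¬p = ⊥-elim (¬p p)

nextMarked : ∀ {n} → ℕ → MTL (suc n)
nextMarked zero    = prop zero
nextMarked (suc j) = Xₘ (nextMarked j)

rankₘ-nextMarked : ∀ {n} j → rankₘ (nextMarked {n} j) ≡ j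
rankₘ-nextMarked zero    = refl
rankₘ-nextMarked (suc j) = cong suc (rankₘ-nextMarked j)

nextMarked-complete : ∀ {n} j {m i} → i + j ≡ m → Satₘ (marked {suc n} m) i (nextMarked j)
nextMarked-complete zero    {m} {i} h = ≡⇒≡ᵇ i m (trans (sym (+-identityʳ i)) h)
nextMarked-complete (suc j) {m} {i} h =
  Satₘ-Xₘ⁺ (nextMarked j) (nextMarked-complete j (trans (sym (+-suc i j)) h))

nextMarked-sound : ∀ {n} j {m i} → Satₘ (marked {suc n} m) i (nextMarked j) → i + j ≡ m
nextMarked-sound zero    {m} {i} sat = trans (+-identityʳ i) (≡ᵇ⇒≡ i m sat)
nextMarked-sound (suc j) {m} {i} sat =
  trans (+-suc i j) (nextMarked-sound j (Satₘ-Xₘ⁻ (nextMarked j) sat))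

corollary3 : (n : ℕ) → 1 ≤ n → (k : ℕ) → 1 ≤ k →
    (Σ (MTL n) λ φ → rankₘ φ ≤ suc k ×
       ((ψ : TPTL n) → rankₜ ψ ≤ k → ¬ (φ ≡ₑ ψ)))
    × (Σ (TPTL n) λ ψ → rankₜ ψ ≤ k ×
       ((φ : MTL n) → rankₘ φ ≤ suc k → ¬ (φ ≡ₑ ψ)))
corollary3 (suc n) _ k 1≤k = mtlOnly , tptlOnly
  where
  mtlOnly : Σ (MTL (suc n)) λ φ → rankₘ φ ≤ suc k ×
              ((ψ : TPTL (suc n)) → rankₜ ψ ≤ k → ¬ (φ ≡ₑ ψ))
  mtlOnly = nextMarked (suc k) , ≤-reflexive (rankₘ-nextMarked (suc k)) , λ ψ rk φ≡ψ →
    let atNear = proj₁ (φ≡ψ (marked (suc k))) (nextMarked-complete (suc k) refl)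
        farIndist = bothFar (suc k) (2 + k) refl refl (n<1+n k) (m<n⇒m<1+n (n<1+n k))
        atFar  = proj₂ (φ≡ψ (marked (2 + k))) (Satₜ-Indist ψ rk farIndist atNear)
    in 1+n≢n (sym (nextMarked-sound (suc k) atFar))
  tptlOnly : Σ (TPTL (suc n)) λ ψ → rankₜ ψ ≤ k ×
               ((φ : MTL (suc n)) → rankₘ φ ≤ suc k → ¬ (φ ≡ₑ ψ))
  tptlOnly = belowUntilMarkedAbove , 1≤k , λ φ _ φ≡ψ →
    let B = boundₘ φ
        atLadder₂ = proj₂ (φ≡ψ (ladder B 2)) (ladder₂⊨belowUntilMarkedAbove {n} B)
    in ladder₃⊭belowUntilMarkedAbove {n} B
         (proj₁ (φ≡ψ (ladder B 3)) (ladder₂⊨⇒ladder₃⊨ φ ≤-refl atLadder₂))
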